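{- For all positive integers $n$ and $N$, $$\sum_{\substack{j_1+j_2+\cdots+j_N=n\\ j_1,j_2,\ldots,j_N\geqslant 0}} b_{j_1}b_{j_2}\cdots b_{j_N}=\sum_{k=0}^{N-1}a_{k}^{(N)}(n)\,b_{n-k},$$ where $b_j$ are the Bernoulli numbers of the second kind and $a_k^{(N)}(x)$ are the polynomials defined in the context.
   Context: The Bernoulli numbers of the second kind $b_0,b_1,b_2,\ldots$ are defined by $\sum_{n=0}^\infty b_nt^n=\frac{t}{\log(1+t)}$, and one sets $b_k=0$ for $k<0$. Define an array of polynomials $\{a_k^{(N)}(x)\}$ (for integers $N\geqslant 1$ and $k$) by $a_0^{(1)}(x)=1$; $a_k^{(N)}(x)=0$ for $k<0$ and for $k\geqslant N$; and, for $N\geqslant 2$ and $0\leqslant k<N$, $$a_{k}^{(N)}(x)=-\frac{1}{N-1}\Big((x-N+1)\,a_{k}^{(N-1)}(x)+(x-N)\,a_{k-1}^{(N-1)}(x-1)\Big).$$ -}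

module Defs where

open import Data.Nat as ℕ using (ℕ; zero; suc; _∸_; _<ᵇ_; _≡ᵇ_)
open import Data.Integer as ℤ using (ℤ; +_)
open import Data.Rational using (ℚ; _+_; _*_; _-_; -_; _/_; 0ℚ; 1ℚ)
open import Data.Bool using (Bool; if_then_else_)
open import Data.List using (List; []; _∷_; map; foldr; upTo; filterᵇ; concatMap)
open import Data.Vec as Vec using (Vec; []; _∷_)
open import Relation.Binary.PropositionalEquality using (_≡_)

Σℚ : List ℚ → ℚ
Σℚ = foldr _+_ 0ℚ

Σ≤ : ℕ → (ℕ → ℚ) → ℚ
Σ≤ n f = Σℚ (map f (upTo (suc n)))

Σ< : ℕ → (ℕ → ℚ) → ℚ
Σ< N f = Σℚ (map f (upTo N))

ι : ℕ → ℚ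
ι n = (+ n) / 1

sgn : ℕ → ℤ
sgn zero = + 1
sgn (suc m) = ℤ.- sgn m

-- coefficients of log(1+t) = Σ_{m≥1} (-1)^(m+1) t^m / m
logCoeff : ℕ → ℚ
logCoeff zero = 0ℚ
logCoeff (suc m) = sgn m / suc m

tCoeff : ℕ → ℚ
tCoeff n = if n ≡ᵇ 1 then 1ℚ else 0ℚ

-- b is the coefficient sequence of t / log(1+t), i.e. (Σ b_n t^n) · log(1+t) = t
-- as formal power series (this determines b uniquely).
IsBernoulli2 : (ℕ → ℚ) → Set
IsBernoulli2 b = ∀ n → Σ≤ n (λ k → b k * logCoeff (n ∸ k)) ≡ tCoeff n

-- b extended by zero to negative indices: bShift b n k = b_{n-k}
bShift : (ℕ → ℚ) → ℕ → ℕ → ℚ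
bShift b n k = if n <ᵇ k then 0ℚ else b (n ∸ k)

-- the polynomials a_k^(N)(x), as functions of x ∈ ℚ; N = 0 is unused (set to 0)
a : ℕ → ℕ → ℚ → ℚ
a zero k x = 0ℚ
a (suc zero) zero x = 1ℚ
a (suc zero) (suc k) x = 0ℚ
a (suc (suc m)) k x =
  if k <ᵇ suc (suc m)
  then (((ℤ.- (+ 1)) / suc m) *
         (((x - ι (suc m)) * a (suc m) k x) + ((x - ι (suc (suc m))) * prev k)))
  else 0ℚ
  where
  prev : ℕ → ℚ
  prev zero = 0ℚ
  prev (suc k') = a (suc m) k' (x - 1ℚ)

boxVecs : (N n : ℕ) → List (Vec ℕ N)
boxVecs zero n = [] ∷ []
boxVecs (suc N) n = concatMap (λ j → map (j ∷_) (boxVecs N n)) (upTo (suc n))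

compositions : (N n : ℕ) → List (Vec ℕ N)
compositions N n = filterᵇ (λ v → Vec.sum v ≡ᵇ n) (boxVecs N n)

prodB : (ℕ → ℚ) → {N : ℕ} → Vec ℕ N → ℚ
prodB b v = foldr _*_ 1ℚ (map b (Vec.toList v))

convPower : (ℕ → ℚ) → ℕ → ℕ → ℚ
convPower b N n = Σℚ (map (prodB b) (compositions N n))

module Submission where

-- Work with formal power series over ℚ, represented by their
-- coefficient sequences ℕ → ℚ up to pointwise equality.  Write B(t) = Σ bₙ tⁿ,
-- L(t) = log(1+t) and θ = t·d/dt for the Euler operator.  From B·L = t one
-- gets, by the Leibniz rule for θ and (1+t)·θL = t, the Riccati-type equation
--     (1+t)·θB = (1+t)·B − B²,
-- and hence for every power (1+t)·θ(Bᴺ) = N·((1+t)·Bᴺ − Bᴺ⁺¹).  Comparing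
-- coefficients of tⁿ turns this into the recurrence
--     [tⁿ]Bᴺ⁺¹ = −(1/N)·((n−N)·[tⁿ]Bᴺ + (n−N−1)·[tⁿ⁻¹]Bᴺ),
-- which is exactly the recurrence defining the polynomials a_k^(N): the sums
-- Σₖ a_k^(N)(n)·b_{n−k} satisfy it for ANY sequence b.  Both sides of the
-- theorem agree for N = 1, so they agree for all N ≥ 1.  Finally the sum over
-- compositions j₁+⋯+j_N = n is the coefficient [tⁿ]Bᴺ.

open import Defs
open import Data.Bool using (Bool; true; false; if_then_else_)
open import Data.Integer as ℤ using (ℤ)
import Data.Integer.Properties as ℤP
open import Data.List using (List; []; _∷_; map; upTo; applyUpTo; filterᵇ; concatMap; _++_)
import Data.List.Properties as LP
open import Data.Nat as ℕ using (ℕ; zero; suc; _∸_; _<_; _≤_; z≤n; s≤s; _<ᵇ_; _≡ᵇ_)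
import Data.Nat.Properties as ℕP
open import Data.Rational using (ℚ; _+_; _*_; _-_; -_; _/_; 0ℚ; 1ℚ; toℚᵘ)
open import Data.Rational.Properties
  using (toℚᵘ-injective; toℚᵘ-fromℚᵘ; toℚᵘ-homo-+; toℚᵘ-homo-*; *-zeroˡ; *-zeroʳ; +-identityˡ; +-identityʳ; +-assoc; *-distribˡ-+)
open import Data.Rational.Solver
open +-*-Solver using (solve; _:=_; _:+_; _:*_; _:-_; :-_; con)
import Data.Rational.Unnormalised as U
import Data.Rational.Unnormalised.Properties as UP
open import Data.Sum using (_⊎_; inj₁; inj₂)
open import Data.Vec as Vec using (Vec; _∷_)
open import Relation.Binary.Bundles using (Setoid)
open import Relation.Binary.PropositionalEquality
import Relation.Binary.Reasoning.Setoid as SetoidReasoning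
open import Relation.Nullary using (yes; no)

ι-suc : ∀ n → ι (suc n) ≡ 1ℚ + ι n
ι-suc n = toℚᵘ-injective (begin
    toℚᵘ (ι (suc n))               ≈⟨ toℚᵘ-fromℚᵘ (U.mkℚᵘ (ℤ.+ suc n) 0) ⟩
    U.mkℚᵘ (ℤ.+ suc n) 0           ≈⟨ U.*≡* cross ⟩
    U.1ℚᵘ U.+ U.mkℚᵘ (ℤ.+ n) 0     ≈⟨ UP.+-congʳ U.1ℚᵘ (UP.≃-sym (toℚᵘ-fromℚᵘ (U.mkℚᵘ (ℤ.+ n) 0))) ⟩
    toℚᵘ 1ℚ U.+ toℚᵘ (ι n)         ≈⟨ UP.≃-sym (toℚᵘ-homo-+ 1ℚ (ι n)) ⟩
    toℚᵘ (1ℚ + ι n)                ∎)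
  where
  open UP.≃-Reasoning
  cross : ℤ.+ suc n ℤ.* ℤ.+ 1 ≡ (ℤ.+ 1 ℤ.* ℤ.+ 1 ℤ.+ ℤ.+ n ℤ.* ℤ.+ 1) ℤ.* ℤ.+ 1
  cross = cong (ℤ._* ℤ.+ 1) (cong (λ z → ℤ.+ 1 ℤ.* ℤ.+ 1 ℤ.+ z) (sym (ℤP.*-identityʳ (ℤ.+ n))))

ι-cancel : ∀ m i → ι (suc m) * (i / suc m) ≡ i / 1
ι-cancel m i = toℚᵘ-injective (begin
    toℚᵘ (ι (suc m) * (i / suc m))         ≈⟨ toℚᵘ-homo-* (ι (suc m)) (i / suc m) ⟩
    toℚᵘ (ι (suc m)) U.* toℚᵘ (i / suc m)  ≈⟨ UP.*-cong (toℚᵘ-fromℚᵘ (U.mkℚᵘ (ℤ.+ suc m) 0)) (toℚᵘ-fromℚᵘ (U.mkℚᵘ i m)) ⟩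
    U.mkℚᵘ (ℤ.+ suc m) 0 U.* U.mkℚᵘ i m    ≈⟨ U.*≡* cross ⟩
    U.mkℚᵘ i 0                             ≈⟨ UP.≃-sym (toℚᵘ-fromℚᵘ (U.mkℚᵘ i 0)) ⟩
    toℚᵘ (i / 1)                           ∎)
  where
  open UP.≃-Reasoning
  cross : (ℤ.+ suc m ℤ.* i) ℤ.* ℤ.+ 1 ≡ i ℤ.* ℤ.+ suc (m ℕ.+ 0)
  cross = trans (ℤP.*-identityʳ _)
         (trans (ℤP.*-comm (ℤ.+ suc m) i) (cong (λ z → i ℤ.* ℤ.+ suc z) (sym (ℕP.+-identityʳ m))))

S : ℕ → (ℕ → ℚ) → ℚ
S zero    f = 0ℚ
S (suc n) f = f 0 + S n (λ k → f (suc k))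

Σℚ-applyUpTo : ∀ n (g : ℕ → ℕ) (f : ℕ → ℚ) → Σℚ (map f (applyUpTo g n)) ≡ S n (λ k → f (g k))
Σℚ-applyUpTo zero    g f = refl
Σℚ-applyUpTo (suc n) g f = cong (f (g 0) +_) (Σℚ-applyUpTo n (λ k → g (suc k)) f)

Σ<≡S : ∀ n (f : ℕ → ℚ) → Σ< n f ≡ S n f
Σ<≡S n f = Σℚ-applyUpTo n (λ k → k) f

S-cong : ∀ n {f g : ℕ → ℚ} → (∀ k → k < n → f k ≡ g k) → S n f ≡ S n g
S-cong zero    e = refl
S-cong (suc n) e = cong₂ _+_ (e 0 (s≤s z≤n)) (S-cong n (λ k k<n → e (suc k) (s≤s k<n)))

S-snoc : ∀ n (f : ℕ → ℚ) → S (suc n) f ≡ S n f + f n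
S-snoc zero    f = solve 1 (λ x → x :+ con 0ℚ := con 0ℚ :+ x) refl (f 0)
S-snoc (suc n) f = trans (cong (f 0 +_) (S-snoc n (λ k → f (suc k))))
  (solve 3 (λ x y z → x :+ (y :+ z) := (x :+ y) :+ z) refl (f 0) (S n (λ k → f (suc k))) (f (suc n)))

S-zero : ∀ n {f : ℕ → ℚ} → (∀ k → k < n → f k ≡ 0ℚ) → S n f ≡ 0ℚ
S-zero zero    e = refl
S-zero (suc n) e = trans (cong₂ _+_ (e 0 (s≤s z≤n)) (S-zero n (λ k k<n → e (suc k) (s≤s k<n)))) refl

-- Linearity, in the shape c·(u·f + v·g) produced by the recurrence for a_k^(N).
S-linear : ∀ n (c u v : ℚ) (f g : ℕ → ℚ) →
  S n (λ k → c * (u * f k + v * g k)) ≡ c * (u * S n f + v * S n g)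
S-linear zero    c u v f g = solve 3 (λ c u v → con 0ℚ := c :* (u :* con 0ℚ :+ v :* con 0ℚ)) refl c u v
S-linear (suc n) c u v f g =
  trans (cong (c * (u * f 0 + v * g 0) +_) (S-linear n c u v (λ k → f (suc k)) (λ k → g (suc k))))
  (solve 7 (λ c u v a b x y → c :* (u :* a :+ v :* b) :+ c :* (u :* x :+ v :* y) := c :* (u :* (a :+ x) :+ v :* (b :+ y)))
     refl c u v (f 0) (g 0) (S n (λ k → f (suc k))) (S n (λ k → g (suc k))))

<ᵇ-true : ∀ k n → k < n → (k <ᵇ n) ≡ true
<ᵇ-true zero    (suc n) _       = refl
<ᵇ-true (suc k) (suc n) (s≤s p) = <ᵇ-true k n p

<ᵇ-false : ∀ k n → n ≤ k → (k <ᵇ n) ≡ false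
<ᵇ-false k       zero    _       = refl
<ᵇ-false (suc k) (suc n) (s≤s p) = <ᵇ-false k n p

S-truncate : ∀ n m (f : ℕ → ℚ) → n ≤ m →
  S (suc m) (λ j → if j <ᵇ suc n then f j else 0ℚ) ≡ S (suc n) f
S-truncate n m f n≤m = subst (λ m' → S (suc m') cut ≡ S (suc n) f) (ℕP.m∸n+n≡m n≤m) (extra (m ∸ n))
  where
  cut : ℕ → ℚ
  cut j = if j <ᵇ suc n then f j else 0ℚ
  extra : ∀ d → S (suc (d ℕ.+ n)) cut ≡ S (suc n) f
  extra zero    = S-cong (suc n) (λ k k<sn → cong (λ β → if β then f k else 0ℚ) (<ᵇ-true k (suc n) k<sn))
  extra (suc d) = begin
    S (suc (suc d ℕ.+ n)) cut            ≡⟨ S-snoc (suc (d ℕ.+ n)) cut ⟩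
    S (suc (d ℕ.+ n)) cut + cut (suc (d ℕ.+ n))
      ≡⟨ cong (λ β → S (suc (d ℕ.+ n)) cut + (if β then f (suc (d ℕ.+ n)) else 0ℚ))
              (<ᵇ-false (suc (d ℕ.+ n)) (suc n) (s≤s (ℕP.m≤n+m n d))) ⟩
    S (suc (d ℕ.+ n)) cut + 0ℚ           ≡⟨ +-identityʳ _ ⟩
    S (suc (d ℕ.+ n)) cut                ≡⟨ extra d ⟩
    S (suc n) f                          ∎
    where open ≡-Reasoning

-- Formal power series: coefficient sequences up to pointwise equality

Seq : Set
Seq = ℕ → ℚ

SeqSetoid : Setoid _ _
SeqSetoid = record
  { Carrier = Seq ; _≈_ = _≗_
  ; isEquivalence = record { refl = λ _ → refl ; sym = λ p n → sym (p n) ; trans = λ p q n → trans (p n) (q n) } }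

module ≗-Reasoning = SetoidReasoning SeqSetoid

infixl 7 _⊛_ _⊙_
infixl 6 _⊕_ _⊖_

_⊛_ : Seq → Seq → Seq
(f ⊛ g) n = S (suc n) (λ k → f k * g (n ∸ k))

_⊕_ _⊖_ : Seq → Seq → Seq
(f ⊕ g) n = f n + g n
(f ⊖ g) n = f n - g n

_⊙_ : ℚ → Seq → Seq
(c ⊙ f) n = c * f n

mulT : Seq → Seq
mulT f zero    = 0ℚ
mulT f (suc n) = f n

mul1+T : Seq → Seq
mul1+T f = f ⊕ mulT f

θ : Seq → Seq
θ f n = ι n * f n

one : Seq
one zero    = 1ℚ
one (suc n) = 0ℚ

tail : Seq → Seq
tail f k = f (suc k)

⊛-cong : ∀ {f f' g g'} → f ≗ f' → g ≗ g' → f ⊛ g ≗ f' ⊛ g'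
⊛-cong ef eg zero    = cong₂ _+_ (cong₂ _*_ (ef 0) (eg 0)) refl
⊛-cong ef eg (suc n) = cong₂ _+_ (cong₂ _*_ (ef 0) (eg (suc n))) (⊛-cong (λ k → ef (suc k)) eg n)

⊛-congˡ : ∀ {f f'} g → f ≗ f' → f ⊛ g ≗ f' ⊛ g
⊛-congˡ g ef = ⊛-cong ef (λ _ → refl)

⊛-congʳ : ∀ f {g g'} → g ≗ g' → f ⊛ g ≗ f ⊛ g'
⊛-congʳ f eg = ⊛-cong {f} {f} (λ _ → refl) eg

⊕-cong : ∀ {f f' g g'} → f ≗ f' → g ≗ g' → f ⊕ g ≗ f' ⊕ g'
⊕-cong e₁ e₂ n = cong₂ _+_ (e₁ n) (e₂ n)

⊖-cong : ∀ {f f' g g'} → f ≗ f' → g ≗ g' → f ⊖ g ≗ f' ⊖ g'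
⊖-cong e₁ e₂ n = cong₂ _-_ (e₁ n) (e₂ n)

⊙-cong : ∀ c {f g} → f ≗ g → c ⊙ f ≗ c ⊙ g
⊙-cong c e n = cong (c *_) (e n)

mulT-cong : ∀ {f g} → f ≗ g → mulT f ≗ mulT g
mulT-cong e zero    = refl
mulT-cong e (suc n) = e n

mulT-injective : ∀ {f g} → mulT f ≗ mulT g → f ≗ g
mulT-injective e n = e (suc n)

mul1+T-cong : ∀ {f g} → f ≗ g → mul1+T f ≗ mul1+T g
mul1+T-cong e = ⊕-cong e (mulT-cong e)

θ-cong : ∀ {f g} → f ≗ g → θ f ≗ θ g
θ-cong e n = cong (ι n *_) (e n)

mul1+T-⊕ : ∀ f g → mul1+T (f ⊕ g) ≗ mul1+T f ⊕ mul1+T g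
mul1+T-⊕ f g zero    = solve 2 (λ a b → (a :+ b) :+ con 0ℚ := (a :+ con 0ℚ) :+ (b :+ con 0ℚ)) refl (f 0) (g 0)
mul1+T-⊕ f g (suc n) = solve 4 (λ a b c d → (a :+ b) :+ (c :+ d) := (a :+ c) :+ (b :+ d)) refl (f (suc n)) (g (suc n)) (f n) (g n)

mulT-⊖ : ∀ f g → mulT (f ⊖ g) ≗ mulT f ⊖ mulT g
mulT-⊖ f g zero    = refl
mulT-⊖ f g (suc n) = refl

mul1+T-mulT : ∀ f → mul1+T (mulT f) ≗ mulT (mul1+T f)
mul1+T-mulT f zero    = refl
mul1+T-mulT f (suc n) = refl

⊛-unfold : ∀ f g → f ⊛ g ≗ f 0 ⊙ g ⊕ mulT (tail f ⊛ g)
⊛-unfold f g zero    = refl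
⊛-unfold f g (suc n) = refl

⊛-unfoldʳ : ∀ f g n → (f ⊛ g) (suc n) ≡ (f ⊛ tail g) n + f (suc n) * g 0
⊛-unfoldʳ f g zero    = solve 3 (λ a b c → a :+ (b :+ con 0ℚ) := (a :+ con 0ℚ) :+ b) refl (f 0 * g 1) (f 1 * g 0) (f 0 * g 1)
⊛-unfoldʳ f g (suc n) = trans (cong (f 0 * g (suc (suc n)) +_) (⊛-unfoldʳ (tail f) g n))
  (solve 3 (λ a x y → a :+ (x :+ y) := (a :+ x) :+ y) refl (f 0 * g (suc (suc n))) ((tail f ⊛ tail g) n) (f (suc (suc n)) * g 0))

⊛-distribʳ-⊕ : ∀ f g h → (f ⊕ g) ⊛ h ≗ f ⊛ h ⊕ g ⊛ h
⊛-distribʳ-⊕ f g h zero    = solve 3 (λ a b c → (a :+ b) :* c :+ con 0ℚ := (a :* c :+ con 0ℚ) :+ (b :* c :+ con 0ℚ)) refl (f 0) (g 0) (h 0)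
⊛-distribʳ-⊕ f g h (suc n) = trans (cong ((f 0 + g 0) * h (suc n) +_) (⊛-distribʳ-⊕ (tail f) (tail g) h n))
  (solve 5 (λ a b c x y → (a :+ b) :* c :+ (x :+ y) := (a :* c :+ x) :+ (b :* c :+ y))
     refl (f 0) (g 0) (h (suc n)) ((tail f ⊛ h) n) ((tail g ⊛ h) n))

⊛-distribʳ-⊖ : ∀ f g h → (f ⊖ g) ⊛ h ≗ f ⊛ h ⊖ g ⊛ h
⊛-distribʳ-⊖ f g h zero    = solve 3 (λ a b c → (a :- b) :* c :+ con 0ℚ := (a :* c :+ con 0ℚ) :- (b :* c :+ con 0ℚ)) refl (f 0) (g 0) (h 0)
⊛-distribʳ-⊖ f g h (suc n) = trans (cong ((f 0 - g 0) * h (suc n) +_) (⊛-distribʳ-⊖ (tail f) (tail g) h n))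
  (solve 5 (λ a b c x y → (a :- b) :* c :+ (x :- y) := (a :* c :+ x) :- (b :* c :+ y))
     refl (f 0) (g 0) (h (suc n)) ((tail f ⊛ h) n) ((tail g ⊛ h) n))

⊛-⊙ˡ : ∀ c f h → (c ⊙ f) ⊛ h ≗ c ⊙ (f ⊛ h)
⊛-⊙ˡ c f h zero    = solve 3 (λ c a b → (c :* a) :* b :+ con 0ℚ := c :* (a :* b :+ con 0ℚ)) refl c (f 0) (h 0)
⊛-⊙ˡ c f h (suc n) = trans (cong ((c * f 0) * h (suc n) +_) (⊛-⊙ˡ c (tail f) h n))
  (solve 4 (λ c a b x → (c :* a) :* b :+ c :* x := c :* (a :* b :+ x)) refl c (f 0) (h (suc n)) ((tail f ⊛ h) n))

⊛-mulTˡ : ∀ f h → mulT f ⊛ h ≗ mulT (f ⊛ h)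
⊛-mulTˡ f h zero    = solve 1 (λ a → con 0ℚ :* a :+ con 0ℚ := con 0ℚ) refl (h 0)
⊛-mulTˡ f h (suc n) = solve 2 (λ a x → con 0ℚ :* a :+ x := x) refl (h (suc n)) ((f ⊛ h) n)

⊛-comm : ∀ f g → f ⊛ g ≗ g ⊛ f
⊛-comm f g zero    = solve 2 (λ a b → a :* b :+ con 0ℚ := b :* a :+ con 0ℚ) refl (f 0) (g 0)
⊛-comm f g (suc n) = trans (cong (f 0 * g (suc n) +_) (⊛-comm (tail f) g n))
  (trans (solve 3 (λ a b x → a :* b :+ x := x :+ b :* a) refl (f 0) (g (suc n)) ((g ⊛ tail f) n))
         (sym (⊛-unfoldʳ g f n)))

⊛-assoc : ∀ f g h → (f ⊛ g) ⊛ h ≗ f ⊛ (g ⊛ h)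
⊛-assoc f g h n = begin
  ((f ⊛ g) ⊛ h) n                                  ≡⟨ ⊛-congˡ h (⊛-unfold f g) n ⟩
  ((f 0 ⊙ g ⊕ mulT (tail f ⊛ g)) ⊛ h) n            ≡⟨ ⊛-distribʳ-⊕ (f 0 ⊙ g) (mulT (tail f ⊛ g)) h n ⟩
  ((f 0 ⊙ g) ⊛ h) n + (mulT (tail f ⊛ g) ⊛ h) n    ≡⟨ cong₂ _+_ (⊛-⊙ˡ (f 0) g h n) (⊛-mulTˡ (tail f ⊛ g) h n) ⟩
  f 0 * (g ⊛ h) n + mulT ((tail f ⊛ g) ⊛ h) n      ≡⟨ cong (f 0 * (g ⊛ h) n +_) (shifted n) ⟩
  f 0 * (g ⊛ h) n + mulT (tail f ⊛ (g ⊛ h)) n      ≡⟨ sym (⊛-unfold f (g ⊛ h) n) ⟩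
  (f ⊛ (g ⊛ h)) n                                  ∎
  where
  open ≡-Reasoning
  shifted : ∀ n → mulT ((tail f ⊛ g) ⊛ h) n ≡ mulT (tail f ⊛ (g ⊛ h)) n
  shifted zero    = refl
  shifted (suc m) = ⊛-assoc (tail f) g h m

⊛-⊙ʳ : ∀ c f h → h ⊛ (c ⊙ f) ≗ c ⊙ (h ⊛ f)
⊛-⊙ʳ c f h n = trans (⊛-comm h (c ⊙ f) n) (trans (⊛-⊙ˡ c f h n) (cong (c *_) (⊛-comm f h n)))

⊛-distribˡ-⊖ : ∀ f g h → h ⊛ (f ⊖ g) ≗ h ⊛ f ⊖ h ⊛ g
⊛-distribˡ-⊖ f g h n = trans (⊛-comm h (f ⊖ g) n) (trans (⊛-distribʳ-⊖ f g h n) (cong₂ _-_ (⊛-comm f h n) (⊛-comm g h n)))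

⊛-mul1+Tˡ : ∀ f h → mul1+T f ⊛ h ≗ mul1+T (f ⊛ h)
⊛-mul1+Tˡ f h n = trans (⊛-distribʳ-⊕ f (mulT f) h n) (cong ((f ⊛ h) n +_) (⊛-mulTˡ f h n))

⊛-mul1+Tʳ : ∀ f h → h ⊛ mul1+T f ≗ mul1+T (h ⊛ f)
⊛-mul1+Tʳ f h n = trans (⊛-comm h (mul1+T f) n) (trans (⊛-mul1+Tˡ f h n) (mul1+T-cong (⊛-comm f h) n))

⊛-identityˡ : ∀ h → one ⊛ h ≗ h
⊛-identityˡ h n = begin
  1ℚ * h n + S n (λ k → 0ℚ * h (n ∸ suc k))  ≡⟨ cong (1ℚ * h n +_) (S-zero n (λ k _ → *-zeroˡ (h (n ∸ suc k)))) ⟩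
  1ℚ * h n + 0ℚ                              ≡⟨ solve 1 (λ a → con 1ℚ :* a :+ con 0ℚ := a) refl (h n) ⟩
  h n                                        ∎
  where open ≡-Reasoning

⊛-identityʳ : ∀ h → h ⊛ one ≗ h
⊛-identityʳ h n = trans (⊛-comm h one n) (⊛-identityˡ h n)

tCoeff≗mulT-one : tCoeff ≗ mulT one
tCoeff≗mulT-one zero          = refl
tCoeff≗mulT-one (suc zero)    = refl
tCoeff≗mulT-one (suc (suc m)) = refl

⊛-tCoeffˡ : ∀ h → tCoeff ⊛ h ≗ mulT h
⊛-tCoeffˡ h n = trans (⊛-congˡ h tCoeff≗mulT-one n) (trans (⊛-mulTˡ one h n) (mulT-cong (⊛-identityˡ h) n))

θ-tail : ∀ f → tail (θ f) ≗ tail f ⊕ θ (tail f)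
θ-tail f k = trans (cong (_* f (suc k)) (ι-suc k)) (solve 2 (λ u a → (con 1ℚ :+ u) :* a := a :+ u :* a) refl (ι k) (f (suc k)))

leibniz : ∀ f g → θ (f ⊛ g) ≗ θ f ⊛ g ⊕ f ⊛ θ g
leibniz f g zero    = solve 2 (λ a b → con 0ℚ :* (a :* b :+ con 0ℚ) := (con 0ℚ :* a :* b :+ con 0ℚ) :+ (a :* (con 0ℚ :* b) :+ con 0ℚ)) refl (f 0) (g 0)
leibniz f g (suc n) = begin
  ι (suc n) * (F * G + C)                                        ≡⟨ cong (_* (F * G + C)) (ι-suc n) ⟩
  (1ℚ + u) * (F * G + C)                                         ≡⟨ solve 5 (λ u F G C D → (con 1ℚ :+ u) :* (F :* G :+ C) := (F :* ((con 1ℚ :+ u) :* G) :+ C) :+ u :* C) refl u F G C D ⟩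
  (F * ((1ℚ + u) * G) + C) + u * C                               ≡⟨ cong ((F * ((1ℚ + u) * G) + C) +_) (leibniz (tail f) g n) ⟩
  (F * ((1ℚ + u) * G) + C) + (D + E)                             ≡⟨ solve 6 (λ u F G C D E → (F :* ((con 1ℚ :+ u) :* G) :+ C) :+ (D :+ E) := (con 0ℚ :* F :* G :+ (C :+ D)) :+ (F :* ((con 1ℚ :+ u) :* G) :+ E)) refl u F G C D E ⟩
  (0ℚ * F * G + (C + D)) + (F * ((1ℚ + u) * G) + E)              ≡⟨ cong₂ (λ x y → (0ℚ * F * G + x) + (F * (y * G) + E)) (sym tail-θ) (sym (ι-suc n)) ⟩
  (0ℚ * F * G + (tail (θ f) ⊛ g) n) + (F * (ι (suc n) * G) + E)  ∎
  where
  open ≡-Reasoning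
  u F G C D E : ℚ
  u = ι n
  F = f 0
  G = g (suc n)
  C = (tail f ⊛ g) n
  D = (θ (tail f) ⊛ g) n
  E = (tail f ⊛ θ g) n
  tail-θ : (tail (θ f) ⊛ g) n ≡ C + D
  tail-θ = trans (⊛-congˡ g (θ-tail f) n) (⊛-distribʳ-⊕ (tail f) (θ (tail f)) g n)

mulT-θ : ∀ f n → mulT (θ f) n ≡ (ι n - 1ℚ) * mulT f n
mulT-θ f zero    = sym (*-zeroʳ (ι 0 - 1ℚ))
mulT-θ f (suc n) = trans (solve 2 (λ u y → u :* y := ((con 1ℚ :+ u) :- con 1ℚ) :* y) refl (ι n) (f n))
                         (cong (λ z → (z - 1ℚ) * f n) (sym (ι-suc n)))

θ-tCoeff : θ tCoeff ≗ tCoeff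
θ-tCoeff zero          = refl
θ-tCoeff (suc zero)    = refl
θ-tCoeff (suc (suc m)) = *-zeroʳ (ι (suc (suc m)))

θ-one : θ one ≗ (λ _ → 0ℚ)
θ-one zero    = refl
θ-one (suc n) = *-zeroʳ (ι (suc n))

sgn±1 : ∀ m → sgn m ≡ ℤ.+ 1 ⊎ sgn m ≡ ℤ.-[1+ 0 ]
sgn±1 zero = inj₁ refl
sgn±1 (suc m) with sgn±1 m
... | inj₁ e = inj₂ (cong ℤ.-_ e)
... | inj₂ e = inj₁ (cong ℤ.-_ e)

sgn-cancel : ∀ m → (ℤ.- sgn m) / 1 + sgn m / 1 ≡ 0ℚ
sgn-cancel m with sgn±1 m
... | inj₁ e rewrite e = refl
... | inj₂ e rewrite e = refl

-- The derivative of log(1+t) is 1/(1+t): (1+t)·θ log(1+t) = t.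
mul1+T-θ-log : mul1+T (θ logCoeff) ≗ tCoeff
mul1+T-θ-log zero          = refl
mul1+T-θ-log (suc zero)    = refl
mul1+T-θ-log (suc (suc m)) = trans (cong₂ _+_ (ι-cancel (suc m) (sgn (suc m))) (ι-cancel m (sgn m))) (sgn-cancel m)

-- The generating function of b and its powers

pow : Seq → ℕ → Seq
pow b zero    = one
pow b (suc N) = b ⊛ pow b N

solve-sum : ∀ a t p → a + t ≡ p → a ≡ p - t
solve-sum a t p e = trans (solve 2 (λ a t → a := (a :+ t) :- t) refl a t) (cong (_- t) e)

module BernoulliSeries (b : Seq) (isB : IsBernoulli2 b) where

  B⊛log : b ⊛ logCoeff ≗ tCoeff
  B⊛log n = trans (sym (Σ<≡S (suc n) (λ k → b k * logCoeff (n ∸ k)))) (isB n)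

  -- Applying (1+t)·θ to B·log(1+t) = t and using (1+t)·θ log(1+t) = t:
  -- (1+t)·θB·log(1+t) = (1+t)·t − t·B.
  θB⊛log : mul1+T (θ b) ⊛ logCoeff ≗ mul1+T tCoeff ⊖ mulT b
  θB⊛log n = solve-sum _ _ _ (differentiated n)
    where
    open ≗-Reasoning
    L : Seq
    L = logCoeff
    B⊛θlog : mul1+T (b ⊛ θ L) ≗ mulT b
    B⊛θlog = begin
      mul1+T (b ⊛ θ L)  ≈⟨ (λ n → sym (⊛-mul1+Tʳ (θ L) b n)) ⟩
      b ⊛ mul1+T (θ L)  ≈⟨ ⊛-congʳ b mul1+T-θ-log ⟩
      b ⊛ tCoeff        ≈⟨ ⊛-comm b tCoeff ⟩
      tCoeff ⊛ b        ≈⟨ ⊛-tCoeffˡ b ⟩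
      mulT b            ∎
    differentiated : mul1+T (θ b) ⊛ L ⊕ mulT b ≗ mul1+T tCoeff
    differentiated = begin
      mul1+T (θ b) ⊛ L ⊕ mulT b                 ≈⟨ ⊕-cong (⊛-mul1+Tˡ (θ b) L) (λ n → sym (B⊛θlog n)) ⟩
      mul1+T (θ b ⊛ L) ⊕ mul1+T (b ⊛ θ L)       ≈⟨ (λ n → sym (mul1+T-⊕ (θ b ⊛ L) (b ⊛ θ L) n)) ⟩
      mul1+T (θ b ⊛ L ⊕ b ⊛ θ L)                ≈⟨ mul1+T-cong (λ n → sym (leibniz b L n)) ⟩
      mul1+T (θ (b ⊛ L))                        ≈⟨ mul1+T-cong (θ-cong B⊛log) ⟩
      mul1+T (θ tCoeff)                         ≈⟨ mul1+T-cong θ-tCoeff ⟩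
      mul1+T tCoeff                             ∎

  -- Multiplying by B = t/log(1+t): (1+t)·θB = (1+t)·B − B².
  riccati : mul1+T (θ b) ≗ mul1+T b ⊖ b ⊛ b
  riccati = mulT-injective (begin
    mulT Q                                        ≈⟨ (λ n → sym (⊛-tCoeffˡ Q n)) ⟩
    tCoeff ⊛ Q                                    ≈⟨ ⊛-comm tCoeff Q ⟩
    Q ⊛ tCoeff                                    ≈⟨ ⊛-congʳ Q (λ n → sym (B⊛log n)) ⟩
    Q ⊛ (b ⊛ logCoeff)                            ≈⟨ ⊛-congʳ Q (⊛-comm b logCoeff) ⟩
    Q ⊛ (logCoeff ⊛ b)                            ≈⟨ (λ n → sym (⊛-assoc Q logCoeff b n)) ⟩
    (Q ⊛ logCoeff) ⊛ b                            ≈⟨ ⊛-congˡ b θB⊛log ⟩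
    (mul1+T tCoeff ⊖ mulT b) ⊛ b                  ≈⟨ ⊛-distribʳ-⊖ (mul1+T tCoeff) (mulT b) b ⟩
    mul1+T tCoeff ⊛ b ⊖ mulT b ⊛ b                ≈⟨ ⊖-cong (⊛-mul1+Tˡ tCoeff b) (⊛-mulTˡ b b) ⟩
    mul1+T (tCoeff ⊛ b) ⊖ mulT (b ⊛ b)            ≈⟨ ⊖-cong (mul1+T-cong (⊛-tCoeffˡ b)) (λ _ → refl) ⟩
    mul1+T (mulT b) ⊖ mulT (b ⊛ b)                ≈⟨ ⊖-cong (mul1+T-mulT b) (λ _ → refl) ⟩
    mulT (mul1+T b) ⊖ mulT (b ⊛ b)                ≈⟨ (λ n → sym (mulT-⊖ (mul1+T b) (b ⊛ b) n)) ⟩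
    mulT (mul1+T b ⊖ b ⊛ b)                       ∎)
    where
    open ≗-Reasoning
    Q : Seq
    Q = mul1+T (θ b)

  pow-equation : ∀ N → mul1+T (θ (pow b N)) ≗ ι N ⊙ (mul1+T (pow b N) ⊖ pow b (suc N))
  pow-equation zero n = trans (constant n) (sym (*-zeroˡ ((mul1+T one ⊖ pow b 1) n)))
    where
    constant : ∀ n → mul1+T (θ one) n ≡ 0ℚ
    constant zero    = refl
    constant (suc n) = cong₂ _+_ (θ-one (suc n)) (θ-one n)
  pow-equation (suc N) = begin
    mul1+T (θ d)                                          ≈⟨ mul1+T-cong (leibniz b c) ⟩
    mul1+T (θ b ⊛ c ⊕ b ⊛ θ c)                            ≈⟨ mul1+T-⊕ (θ b ⊛ c) (b ⊛ θ c) ⟩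
    mul1+T (θ b ⊛ c) ⊕ mul1+T (b ⊛ θ c)                   ≈⟨ ⊕-cong (λ n → sym (⊛-mul1+Tˡ (θ b) c n)) (λ n → sym (⊛-mul1+Tʳ (θ c) b n)) ⟩
    mul1+T (θ b) ⊛ c ⊕ b ⊛ mul1+T (θ c)                   ≈⟨ ⊕-cong (⊛-congˡ c riccati) (⊛-congʳ b (pow-equation N)) ⟩
    (mul1+T b ⊖ b ⊛ b) ⊛ c ⊕ b ⊛ (ι N ⊙ (mul1+T c ⊖ d))   ≈⟨ ⊕-cong (⊛-distribʳ-⊖ (mul1+T b) (b ⊛ b) c)
                                                                    (λ n → trans (⊛-⊙ʳ (ι N) (mul1+T c ⊖ d) b n) (cong (ι N *_) (⊛-distribˡ-⊖ (mul1+T c) d b n))) ⟩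
    (mul1+T b ⊛ c ⊖ (b ⊛ b) ⊛ c) ⊕ ι N ⊙ (b ⊛ mul1+T c ⊖ b ⊛ d)
                                                          ≈⟨ ⊕-cong (⊖-cong (⊛-mul1+Tˡ b c) (⊛-assoc b b c)) (⊙-cong (ι N) (⊖-cong (⊛-mul1+Tʳ c b) (λ _ → refl))) ⟩
    (mul1+T d ⊖ e) ⊕ ι N ⊙ (mul1+T d ⊖ e)                 ≈⟨ (λ n → solve 2 (λ x u → x :+ u :* x := (con 1ℚ :+ u) :* x) refl ((mul1+T d ⊖ e) n) (ι N)) ⟩
    (1ℚ + ι N) ⊙ (mul1+T d ⊖ e)                           ≈⟨ (λ n → cong (_* (mul1+T d ⊖ e) n) (sym (ι-suc N))) ⟩
    ι (suc N) ⊙ (mul1+T d ⊖ e)                            ∎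
    where
    open ≗-Reasoning
    c d e : Seq
    c = pow b N
    d = b ⊛ c
    e = b ⊛ d

-- The coefficient recurrence

c₀ : ℕ → ℚ
c₀ m = (ℤ.- (ℤ.+ 1)) / suc m

step : ℕ → Seq → Seq
step m c n = c₀ m * ((ι n - ι (suc m)) * c n + (ι n - ι (suc (suc m))) * mulT c n)

step-cong : ∀ m {c c'} → c ≗ c' → step m c ≗ step m c'
step-cong m e n = cong₂ (λ p q → c₀ m * ((ι n - ι (suc m)) * p + (ι n - ι (suc (suc m))) * q)) (e n) (mulT-cong e n)

isolate : ∀ c N x C D E → N * c ≡ - 1ℚ → x * C + (x - 1ℚ) * D ≡ N * ((C + D) - E) →
  E ≡ c * ((x - N) * C + (x - (1ℚ + N)) * D)
isolate c N x C D E Nc≡-1 e = sym (begin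
  c * ((x - N) * C + (x - (1ℚ + N)) * D)  ≡⟨ solve 5 (λ c N x C D → c :* ((x :- N) :* C :+ (x :- (con 1ℚ :+ N)) :* D) := c :* ((x :* C :+ (x :- con 1ℚ) :* D) :- N :* (C :+ D))) refl c N x C D ⟩
  c * ((x * C + (x - 1ℚ) * D) - N * (C + D)) ≡⟨ cong (λ z → c * (z - N * (C + D))) e ⟩
  c * (N * ((C + D) - E) - N * (C + D))   ≡⟨ solve 5 (λ c N C D E → c :* (N :* ((C :+ D) :- E) :- N :* (C :+ D)) := :- ((N :* c) :* E)) refl c N C D E ⟩
  - ((N * c) * E)                         ≡⟨ cong (λ z → - (z * E)) Nc≡-1 ⟩
  - (- 1ℚ * E)                            ≡⟨ solve 1 (λ E → :- (:- con 1ℚ :* E) := E) refl E ⟩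
  E                                       ∎)
  where open ≡-Reasoning

pow-step : ∀ b → IsBernoulli2 b → ∀ m → pow b (suc (suc m)) ≗ step m (pow b (suc m))
pow-step b isB m n =
  trans (isolate (c₀ m) (ι (suc m)) (ι n) C D E (ι-cancel m (ℤ.- (ℤ.+ 1))) coefficient)
        (cong (λ z → c₀ m * ((ι n - ι (suc m)) * C + (ι n - z) * D)) (sym (ι-suc (suc m))))
  where
  open BernoulliSeries b isB
  C D E : ℚ
  C = pow b (suc m) n
  D = mulT (pow b (suc m)) n
  E = pow b (suc (suc m)) n
  coefficient : ι n * C + (ι n - 1ℚ) * D ≡ ι (suc m) * ((C + D) - E)
  coefficient = trans (cong (ι n * C +_) (sym (mulT-θ (pow b (suc m)) n))) (pow-equation (suc m) n)

aSum : Seq → ℕ → Seq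
aSum b N n = S N (λ k → a N k (ι n) * bShift b n k)

a-top : ∀ m x → a (suc m) (suc m) x ≡ 0ℚ
a-top zero    x = refl
a-top (suc m) x rewrite <ᵇ-false (suc (suc m)) (suc (suc m)) ℕP.≤-refl = refl

a-prev : ℕ → ℚ → ℕ → ℚ
a-prev m x zero    = 0ℚ
a-prev m x (suc k) = a (suc m) k (x - 1ℚ)

if-true : ∀ {β : Bool} {x y : ℚ} → β ≡ true → (if β then x else y) ≡ x
if-true refl = refl

scale-distrib : ∀ c u v A B y → (c * (u * A + v * B)) * y ≡ c * (u * (A * y) + v * (B * y))
scale-distrib = solve 6 (λ c u v A B y → (c :* (u :* A :+ v :* B)) :* y := c :* (u :* (A :* y) :+ v :* (B :* y))) refl

a-step-term : ∀ b m x n k → k < suc (suc m) →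
  a (suc (suc m)) k x * bShift b n k
    ≡ c₀ m * ((x - ι (suc m)) * (a (suc m) k x * bShift b n k) + (x - ι (suc (suc m))) * (a-prev m x k * bShift b n k))
a-step-term b m x n zero    _       =
  scale-distrib (c₀ m) (x - ι (suc m)) (x - ι (suc (suc m))) (a (suc m) 0 x) 0ℚ (bShift b n 0)
a-step-term b m x n (suc k) (s≤s h) = trans (cong (_* bShift b n (suc k)) (if-true (<ᵇ-true k (suc m) h)))
  (scale-distrib (c₀ m) (x - ι (suc m)) (x - ι (suc (suc m))) (a (suc m) (suc k) x) (a (suc m) k (x - 1ℚ)) (bShift b n (suc k)))

ι-pred : ∀ n → ι (suc n) - 1ℚ ≡ ι n
ι-pred n = trans (cong (_- 1ℚ) (ι-suc n)) (solve 1 (λ u → (con 1ℚ :+ u) :- con 1ℚ := u) refl (ι n))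

aSum-shift : ∀ b m n → S (suc (suc m)) (λ k → a-prev m (ι n) k * bShift b n k) ≡ mulT (aSum b (suc m)) n
aSum-shift b m zero    = cong₂ _+_ (*-zeroˡ (b 0)) (S-zero (suc m) (λ k _ → *-zeroʳ (a (suc m) k (ι 0 - 1ℚ))))
aSum-shift b m (suc n) = trans
  (cong₂ _+_ (*-zeroˡ (bShift b (suc n) 0)) (S-cong (suc m) (λ k _ → cong (λ z → a (suc m) k z * bShift b n k) (ι-pred n))))
  (+-identityˡ _)

aSum-step : ∀ b m → aSum b (suc (suc m)) ≗ step m (aSum b (suc m))
aSum-step b m n = begin
  aSum b (suc (suc m)) n                                  ≡⟨ S-cong (suc (suc m)) (a-step-term b m x n) ⟩
  S (suc (suc m)) (λ k → c₀ m * (u * f k + v * g k))      ≡⟨ S-linear (suc (suc m)) (c₀ m) u v f g ⟩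
  c₀ m * (u * S (suc (suc m)) f + v * S (suc (suc m)) g)  ≡⟨ cong₂ (λ p q → c₀ m * (u * p + v * q)) drop-top (aSum-shift b m n) ⟩
  step m (aSum b (suc m)) n                               ∎
  where
  open ≡-Reasoning
  x u v : ℚ
  x = ι n
  u = x - ι (suc m)
  v = x - ι (suc (suc m))
  f g : ℕ → ℚ
  f k = a (suc m) k x * bShift b n k
  g k = a-prev m x k * bShift b n k
  drop-top : S (suc (suc m)) f ≡ aSum b (suc m) n
  drop-top = begin
    S (suc (suc m)) f                     ≡⟨ S-snoc (suc m) f ⟩
    S (suc m) f + a (suc m) (suc m) x * bShift b n (suc m)
                                          ≡⟨ cong (λ z → S (suc m) f + z * bShift b n (suc m)) (a-top m x) ⟩
    S (suc m) f + 0ℚ * bShift b n (suc m) ≡⟨ cong (S (suc m) f +_) (*-zeroˡ (bShift b n (suc m))) ⟩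
    S (suc m) f + 0ℚ                      ≡⟨ +-identityʳ _ ⟩
    S (suc m) f                           ∎

-- Both sides start from B¹ = B and follow the same recurrence.
pow≗aSum : ∀ b → IsBernoulli2 b → ∀ m → pow b (suc m) ≗ aSum b (suc m)
pow≗aSum b isB zero    n = trans (⊛-identityʳ b n) (solve 1 (λ y → y := con 1ℚ :* y :+ con 0ℚ) refl (b n))
pow≗aSum b isB (suc m) n = begin
  pow b (suc (suc m)) n      ≡⟨ pow-step b isB m n ⟩
  step m (pow b (suc m)) n   ≡⟨ step-cong m (pow≗aSum b isB m) n ⟩
  step m (aSum b (suc m)) n  ≡⟨ sym (aSum-step b m n) ⟩
  aSum b (suc (suc m)) n     ∎
  where open ≡-Reasoning

-- Sums over compositions are coefficients of powers

Σ-filterᵇ : ∀ {A : Set} (p : A → Bool) (f : A → ℚ) xs →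
  Σℚ (map f (filterᵇ p xs)) ≡ Σℚ (map (λ x → if p x then f x else 0ℚ) xs)
Σ-filterᵇ p f []       = refl
Σ-filterᵇ p f (x ∷ xs) with p x
... | true  = cong (f x +_) (Σ-filterᵇ p f xs)
... | false = trans (Σ-filterᵇ p f xs) (sym (+-identityˡ _))

Σ-++ : ∀ (xs ys : List ℚ) → Σℚ (xs ++ ys) ≡ Σℚ xs + Σℚ ys
Σ-++ []       ys = sym (+-identityˡ _)
Σ-++ (x ∷ xs) ys = trans (cong (x +_) (Σ-++ xs ys)) (sym (+-assoc x (Σℚ xs) (Σℚ ys)))

Σ-concatMap : ∀ {A B : Set} (f : B → ℚ) (g : A → List B) xs →
  Σℚ (map f (concatMap g xs)) ≡ Σℚ (map (λ x → Σℚ (map f (g x))) xs)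
Σ-concatMap f g []       = refl
Σ-concatMap f g (x ∷ xs) = trans (cong Σℚ (LP.map-++ f (g x) (concatMap g xs)))
  (trans (Σ-++ (map f (g x)) (map f (concatMap g xs))) (cong (Σℚ (map f (g x)) +_) (Σ-concatMap f g xs)))

Σ-cong : ∀ {A : Set} {f g : A → ℚ} → (∀ x → f x ≡ g x) → ∀ xs → Σℚ (map f xs) ≡ Σℚ (map g xs)
Σ-cong e xs = cong Σℚ (LP.map-cong e xs)

Σ-scale : ∀ {A : Set} (c : ℚ) (f : A → ℚ) xs → Σℚ (map (λ x → c * f x) xs) ≡ c * Σℚ (map f xs)
Σ-scale c f []       = sym (*-zeroʳ c)
Σ-scale c f (x ∷ xs) = trans (cong (c * f x +_) (Σ-scale c f xs)) (sym (*-distribˡ-+ c (f x) (Σℚ (map f xs))))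

Σ-zero : ∀ {A : Set} (xs : List A) → Σℚ (map (λ _ → 0ℚ) xs) ≡ 0ℚ
Σ-zero []       = refl
Σ-zero (x ∷ xs) = cong (0ℚ +_) (Σ-zero xs)

≡ᵇ-shift : ∀ j n s → j ≤ n → (j ℕ.+ s ≡ᵇ n) ≡ (s ≡ᵇ n ∸ j)
≡ᵇ-shift zero    n       s _       = refl
≡ᵇ-shift (suc j) (suc n) s (s≤s p) = ≡ᵇ-shift j n s p

≡ᵇ-false : ∀ j n s → n < j → (j ℕ.+ s ≡ᵇ n) ≡ false
≡ᵇ-false (suc j) zero    s _       = refl
≡ᵇ-false (suc j) (suc n) s (s≤s p) = ≡ᵇ-false j n s p

if-* : ∀ (β : Bool) c y → (if β then c * y else 0ℚ) ≡ c * (if β then y else 0ℚ)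
if-* true  c y = refl
if-* false c y = sym (*-zeroʳ c)

-- Σ b_{j₁}⋯b_{j_N} over (j₁,…,j_N) ∈ [0,m]ᴺ with j₁+⋯+j_N = n;
-- convPower b N n is the case m = n.
boxSum : Seq → ℕ → ℕ → ℕ → ℚ
boxSum b N m n = Σℚ (map (prodB b) (filterᵇ (λ v → Vec.sum v ≡ᵇ n) (boxVecs N m)))

-- Fixing the first coordinate j₁ = j leaves b_j times a sum for N,
-- which by hypothesis is [t^{n−j}]Bᴺ.
first-coordinate : ∀ b N m n j → (∀ n' → n' ≤ m → boxSum b N m n' ≡ pow b N n') → n ≤ m →
  Σℚ (map (λ v → if (j ℕ.+ Vec.sum v ≡ᵇ n) then b j * prodB b v else 0ℚ) (boxVecs N m))
    ≡ (if j <ᵇ suc n then b j * pow b N (n ∸ j) else 0ℚ)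
first-coordinate b N m n j hyp n≤m with j ℕP.≤? n
... | yes j≤n rewrite <ᵇ-true j (suc n) (s≤s j≤n) = begin
    Σℚ (map (λ v → if (j ℕ.+ Vec.sum v ≡ᵇ n) then b j * prodB b v else 0ℚ) (boxVecs N m))
      ≡⟨ Σ-cong (λ v → trans (cong (λ β → if β then b j * prodB b v else 0ℚ) (≡ᵇ-shift j n (Vec.sum v) j≤n))
                             (if-* (Vec.sum v ≡ᵇ n ∸ j) (b j) (prodB b v))) (boxVecs N m) ⟩
    Σℚ (map (λ v → b j * (if (Vec.sum v ≡ᵇ n ∸ j) then prodB b v else 0ℚ)) (boxVecs N m))
      ≡⟨ Σ-scale (b j) (λ v → if (Vec.sum v ≡ᵇ n ∸ j) then prodB b v else 0ℚ) (boxVecs N m) ⟩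
    b j * Σℚ (map (λ v → if (Vec.sum v ≡ᵇ n ∸ j) then prodB b v else 0ℚ) (boxVecs N m))
      ≡⟨ cong (b j *_) (sym (Σ-filterᵇ (λ v → Vec.sum v ≡ᵇ n ∸ j) (prodB b) (boxVecs N m))) ⟩
    b j * boxSum b N m (n ∸ j)
      ≡⟨ cong (b j *_) (hyp (n ∸ j) (ℕP.≤-trans (ℕP.m∸n≤m n j) n≤m)) ⟩
    b j * pow b N (n ∸ j) ∎
  where open ≡-Reasoning
... | no j≰n rewrite <ᵇ-false j (suc n) (ℕP.≰⇒> j≰n) = trans
  (Σ-cong (λ v → cong (λ β → if β then b j * prodB b v else 0ℚ) (≡ᵇ-false j n (Vec.sum v) (ℕP.≰⇒> j≰n))) (boxVecs N m))
  (Σ-zero (boxVecs N m))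

boxSum≡pow : ∀ b N m n → n ≤ m → boxSum b N m n ≡ pow b N n
boxSum≡pow b zero    m zero    _   = refl
boxSum≡pow b zero    m (suc n) _   = refl
boxSum≡pow b (suc N) m n       n≤m = begin
  boxSum b (suc N) m n                                       ≡⟨ Σ-filterᵇ p (prodB b) (concatMap G (upTo (suc m))) ⟩
  Σℚ (map term (concatMap G (upTo (suc m))))                 ≡⟨ Σ-concatMap term G (upTo (suc m)) ⟩
  Σℚ (map (λ j → Σℚ (map term (G j))) (upTo (suc m)))        ≡⟨ Σ-cong (λ j → trans (cong Σℚ (sym (LP.map-∘ (boxVecs N m))))
                                                                                    (first-coordinate b N m n j (λ n' → boxSum≡pow b N m n') n≤m))
                                                                       (upTo (suc m)) ⟩
  Σℚ (map cut (upTo (suc m)))                                ≡⟨ Σ<≡S (suc m) cut ⟩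
  S (suc m) cut                                              ≡⟨ S-truncate n m (λ j → b j * pow b N (n ∸ j)) n≤m ⟩
  pow b (suc N) n                                            ∎
  where
  open ≡-Reasoning
  p : Vec ℕ (suc N) → Bool
  p v = Vec.sum v ≡ᵇ n
  term : Vec ℕ (suc N) → ℚ
  term v = if p v then prodB b v else 0ℚ
  G : ℕ → List (Vec ℕ (suc N))
  G j = map (j ∷_) (boxVecs N m)
  cut : ℕ → ℚ
  cut j = if j <ᵇ suc n then b j * pow b N (n ∸ j) else 0ℚ

convPower≡pow : ∀ b N n → convPower b N n ≡ pow b N n
convPower≡pow b N n = boxSum≡pow b N n n ℕP.≤-refl

theorem1 : (b : ℕ → ℚ) → IsBernoulli2 b →
    (n N : ℕ) → 1 ≤ n → 1 ≤ N →
    convPower b N n ≡ Σ< N (λ k → a N k (ι n) * bShift b n k)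
theorem1 b isB n zero    _ ()
theorem1 b isB n (suc m) _ _ = begin
  convPower b (suc m) n                             ≡⟨ convPower≡pow b (suc m) n ⟩
  pow b (suc m) n                                   ≡⟨ pow≗aSum b isB m n ⟩
  aSum b (suc m) n                                  ≡⟨ sym (Σ<≡S (suc m) (λ k → a (suc m) k (ι n) * bShift b n k)) ⟩
  Σ< (suc m) (λ k → a (suc m) k (ι n) * bShift b n k) ∎
  where open ≡-Reasoning
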